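{- Let $p,q$ be positive integers and $d>1$ a divisor of $pq$. If $H(p,q,d)$ is a line digraph (i.e. isomorphic to $L(G')$ for some digraph $G'$), then $\gcd(p,q)$ is a multiple of $d$.
   Context: For integers $a\le b$, $[a,b]=\{c\in\mathbb{Z}: a\le c\le b\}$. Digraphs may have loops and multiple arcs. For positive integers $p,q$, every $a\in[0,pq-1]$ is written uniquely as $a=iq+j$ with $i\in[0,p-1]$, $j\in[0,q-1]$, denoted $a=(i,j)_{p,q}$. For a divisor $d>1$ of $pq$, the digraph $H(p,q,d)$ has vertex set $[0,pq/d-1]$, where vertex $k$ represents the block $[kd,kd+d-1]$; for each $i\in[0,p-1]$, $j\in[0,q-1]$ there is one arc from the vertex whose block contains $iq+j$ to the vertex whose block contains $(q-1-j)p+(p-1-i)$ (arcs counted with multiplicity). The line digraph $L(G)$ of a digraph $G$ has the arcs of $G$ as vertices, with an arc from $(u,v)$ to $(v,w)$ whenever these are arcs of $G$. -}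

module Defs where

open import Data.Nat using (ℕ; zero; suc; _+_; _*_; _∸_; _<_; _≤_; s≤s; z≤n; NonZero)
open import Data.Nat.Properties
open import Data.Nat.DivMod using (_/_; m/n*n≡m; m<n*o⇒m/o<n)
open import Data.Nat.Divisibility using (_∣_)
open import Data.Fin using (Fin; toℕ; fromℕ<)
open import Data.Fin.Properties using (toℕ<n)
open import Data.Product using (Σ; _×_; _,_; proj₁; proj₂)
open import Function.Bundles using (_⤖_; Bijection)
open import Relation.Binary.PropositionalEquality using (_≡_; subst; sym)

record Digraph : Set₁ where
  field
    V    : Set
    A    : Set
    tail : A → V
    head : A → V

record FinDigraph : Set where
  field
    nV   : ℕ
    nA   : ℕ
    tail : Fin nA → Fin nV
    head : Fin nA → Fin nV

toDigraph : FinDigraph → Digraph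
toDigraph G = record { V = Fin nV ; A = Fin nA ; tail = tail ; head = head }
  where open FinDigraph G

L : Digraph → Digraph
L G = record
  { V    = A
  ; A    = Σ (A × A) (λ ef → head (proj₁ ef) ≡ tail (proj₂ ef))
  ; tail = λ x → proj₁ (proj₁ x)
  ; head = λ x → proj₂ (proj₁ x)
  }
  where open Digraph G

record _≅_ (G H : Digraph) : Set where
  private
    module G = Digraph G
    module H = Digraph H
  field
    vmap  : G.V ⤖ H.V
    amap  : G.A ⤖ H.A
    tail-comm : ∀ a → Bijection.to vmap (G.tail a) ≡ H.tail (Bijection.to amap a)
    head-comm : ∀ a → Bijection.to vmap (G.head a) ≡ H.head (Bijection.to amap a)

IsLineDigraph : Digraph → Set
IsLineDigraph H = Σ FinDigraph (λ G' → H ≅ L (toDigraph G'))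

pair<pq : ∀ {p q i j} → i < p → j < q → i * q + j < p * q
pair<pq {suc p} {q} {i} {j} i<p j<q = begin-strict
    i * q + j   <⟨ +-monoʳ-< (i * q) j<q ⟩
    i * q + q   ≡⟨ +-comm (i * q) q ⟩
    suc i * q   ≤⟨ *-monoˡ-≤ q i<p ⟩
    suc p * q   ∎
  where open ≤-Reasoning

block : ∀ p q d .{{_ : NonZero d}} → d ∣ p * q → (m : ℕ) → m < p * q → Fin (p * q / d)
block p q d d∣pq m m<pq =
  fromℕ< (m<n*o⇒m/o<n (subst (m <_) (sym (m/n*n≡m d∣pq)) m<pq))

H : ∀ p q d .{{_ : NonZero d}} → d ∣ p * q → Digraph
H p q d d∣pq = record
  { V    = Fin (p * q / d)
  ; A    = Fin p × Fin q
  ; tail = λ { (i , j) → block p q d d∣pq (toℕ i * q + toℕ j) (pair<pq (toℕ<n i) (toℕ<n j)) }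
  ; head = λ { (i , j) → block p q d d∣pq
                 ((q ∸ 1 ∸ toℕ j) * p + (p ∸ 1 ∸ toℕ i))
                 (subst (((q ∸ 1 ∸ toℕ j) * p + (p ∸ 1 ∸ toℕ i)) <_) (*-comm q p) (pair<pq (rev j) (rev i))) }
  }
  where
    rev : ∀ {n} (k : Fin n) → n ∸ 1 ∸ toℕ k < n
    rev {suc n} k = s≤s (≤-trans (m∸n≤m n (toℕ k)) ≤-refl)

{-# OPTIONS --safe #-}
-- A line digraph has no parallel arcs, and whenever u → w, u → x and v → w are arcs so
-- is v → x.  Suppose d ∤ q and p ≥ 2.  If q < d, the arcs (0,0) and (1,0) of H(p,q,d)
-- are parallel: both start in block 0, and they end at pq-1 and pq-2, which share a
-- block since d ∣ pq.  If q > d, take a = (p-2,q-1), b = (p-1,q-1), c = (p-1,0): a and c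
-- start at (p-1)q - 1 and (p-1)q, in one block as d ∤ (p-1)q, and a and b end in block 0.
-- So some arc leaves the last block, i.e. starts within d of pq, and enters the block of
-- (q-1)p, which is at least p; but such an arc has j ≥ q - d, so it ends below block p.
-- Hence d ∣ q, and d ∣ p because (i,j) ↦ (q-1-j,p-1-i) turns H(q,p,d) into the converse
-- of H(p,q,d), and the two properties above are symmetric under reversing arcs.
module Submission where

open import Defs
open import Axiom.UniquenessOfIdentityProofs using (UIP; module Decidable⇒UIP)
open import Data.Fin using (Fin; zero; suc; toℕ; opposite)
open import Data.Fin.Properties
  using (toℕ-fromℕ<; toℕ-injective; toℕ<n; opposite-prop; opposite-involutive)
  renaming (_≟_ to _≟ᶠ_)
open import Data.Nat using (ℕ; zero; suc; _+_; _*_; _∸_; _<_; _≤_; z<s; NonZero)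
open import Data.Nat.DivMod
  using (_/_; _%_; m≡m%n+[m/n]*n; m%n<n; m/n*n≤m; m*n/n≡m; /-monoˡ-≤; m<n⇒m/n≡0; m<n*o⇒m/o<n)
open import Data.Nat.Divisibility
  using (_∣_; divides; _∣?_; _∣0; ∣-refl; ∣1⇒≡1; ∣m+n∣m⇒∣n)
open import Data.Nat.GCD using (gcd; gcd-greatest)
open import Data.Nat.Properties
open import Data.Nat.Tactic.RingSolver using (solve)
open import Data.List using (_∷_; [])
open import Data.Product using (∃-syntax; _×_; _,_)
open import Function using (id)
open import Function.Bundles using (_⤖_; _⇔_; mk⇔; mk↔ₛ′; Bijection; Equivalence)
open import Function.Construct.Identity using (⤖-id; ⇔-id)
open import Function.Construct.Symmetry using (⇔-sym)
open import Function.Definitions using (Injective)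
open import Function.Properties.Inverse using (↔⇒⤖)
open import Relation.Binary.Definitions using (tri<; tri≈; tri>)
open import Relation.Binary.PropositionalEquality
open import Relation.Nullary using (¬_; yes; no; contradiction)

record LineLike (X : Digraph) : Set where
  open Digraph X
  field
    parallel-free : ∀ {a b} → tail a ≡ tail b → head a ≡ head b → a ≡ b
    closed        : ∀ {a b c} → tail a ≡ tail c → head a ≡ head b →
                    ∃[ e ] tail e ≡ tail b × head e ≡ head c

L-LineLike : (G : Digraph) → UIP (Digraph.V G) → LineLike (L G)
L-LineLike G uip = record
  { parallel-free = parallel-free
  ; closed        = λ {x} {y} {z} → closed {x} {y} {z}
  }
  where
  module LG = Digraph (L G)

  parallel-free : ∀ {x y} → LG.tail x ≡ LG.tail y → LG.head x ≡ LG.head y → x ≡ y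
  parallel-free {(e , f) , ef} {(.e , .f) , ef′} refl refl = cong ((e , f) ,_) (uip ef ef′)

  closed : ∀ {x y z} → LG.tail x ≡ LG.tail z → LG.head x ≡ LG.head y →
           ∃[ w ] LG.tail w ≡ LG.tail y × LG.head w ≡ LG.head z
  closed {(e , f) , ef} {(e′ , .f) , e′f} {(.e , f′) , ef′} refl refl =
    ((e′ , f′) , trans e′f (trans (sym ef) ef′)) , refl , refl

reverse : Digraph → Digraph
reverse X = record { V = V ; A = A ; tail = head ; head = tail }
  where open Digraph X

LineLike-reverse : ∀ {X} → LineLike X → LineLike (reverse X)
LineLike-reverse line = record
  { parallel-free = λ same-head same-tail → parallel-free same-tail same-head
  ; closed        = λ same-head same-tail →
      let e , tail-e , head-e = closed same-tail same-head in e , head-e , tail-e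
  }
  where open LineLike line

injection-⇔ : ∀ {A B C : Set} {s : A → B} {t : A → C} (f : B → C) →
              Injective _≡_ _≡_ f → (∀ a → f (s a) ≡ t a) →
              ∀ {a b} → s a ≡ s b ⇔ t a ≡ t b
injection-⇔ f f-injective f∘s≗t {a} {b} = mk⇔
  (λ eq → trans (sym (f∘s≗t a)) (trans (cong f eq) (f∘s≗t b)))
  (λ eq → f-injective (trans (f∘s≗t a) (trans eq (sym (f∘s≗t b)))))

module _ {X Y : Digraph} where
  private
    module X = Digraph X
    module Y = Digraph Y

  LineLike-transfer : (φ : X.A ⤖ Y.A) →
    (∀ {a b} → X.tail a ≡ X.tail b ⇔ Y.tail (Bijection.to φ a) ≡ Y.tail (Bijection.to φ b)) →
    (∀ {a b} → X.head a ≡ X.head b ⇔ Y.head (Bijection.to φ a) ≡ Y.head (Bijection.to φ b)) →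
    LineLike Y → LineLike X
  LineLike-transfer φ tail⇔ head⇔ line = record
    { parallel-free = λ same-tail same-head →
        injective (parallel-free (Equivalence.to tail⇔ same-tail)
                                 (Equivalence.to head⇔ same-head))
    ; closed = λ same-tail same-head →
        let e′ , tail-e′ , head-e′ = closed (Equivalence.to tail⇔ same-tail)
                                            (Equivalence.to head⇔ same-head)
            e , φe≡e′ = strictlySurjective e′
        in e , Equivalence.from tail⇔ (trans (cong Y.tail φe≡e′) tail-e′)
             , Equivalence.from head⇔ (trans (cong Y.head φe≡e′) head-e′)
    }
    where
    open Bijection φ using (injective; strictlySurjective)
    open LineLike line

IsLineDigraph⇒LineLike : ∀ {X} → IsLineDigraph X → LineLike X
IsLineDigraph⇒LineLike (G , iso) =
  LineLike-transfer amap
    (injection-⇔ (Bijection.to vmap) (Bijection.injective vmap) tail-comm)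
    (injection-⇔ (Bijection.to vmap) (Bijection.injective vmap) head-comm)
    (L-LineLike (toDigraph G) (Decidable⇒UIP.≡-irrelevant _≟ᶠ_))
  where open _≅_ iso

position : ∀ {p q} → Fin p × Fin q → ℕ
position {q = q} (i , j) = toℕ i * q + toℕ j

transpose : ∀ {p q} → Fin p × Fin q → Fin q × Fin p
transpose (i , j) = opposite j , opposite i

transpose-involutive : ∀ {p q} (x : Fin p × Fin q) → transpose (transpose x) ≡ x
transpose-involutive (i , j) = cong₂ _,_ (opposite-involutive i) (opposite-involutive j)

position-transpose : ∀ {p q} (i : Fin p) (j : Fin q) →
                     position (transpose (i , j)) ≡ (q ∸ suc (toℕ j)) * p + (p ∸ suc (toℕ i))
position-transpose {p} i j = cong₂ (λ m n → m * p + n) (opposite-prop j) (opposite-prop i)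

transpose-⤖ : ∀ {p q} → (Fin p × Fin q) ⤖ (Fin q × Fin p)
transpose-⤖ = ↔⇒⤖ (mk↔ₛ′ transpose transpose transpose-involutive transpose-involutive)

Hℕ : ∀ p q d .{{_ : NonZero d}} → Digraph
Hℕ p q d = record
  { V    = ℕ
  ; A    = Fin p × Fin q
  ; tail = λ x → position x / d
  ; head = λ x → position (transpose x) / d
  }

module _ {p q d} .{{_ : NonZero d}} (d∣pq : d ∣ p * q) where
  private
    module H = Digraph (H p q d d∣pq)
    module Hℕ = Digraph (Hℕ p q d)

  toℕ-tail : ∀ x → toℕ (H.tail x) ≡ Hℕ.tail x
  toℕ-tail (i , j) = toℕ-fromℕ< _

  toℕ-head : ∀ x → toℕ (H.head x) ≡ Hℕ.head x
  toℕ-head (i , j) = trans (toℕ-fromℕ< _)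
    (cong (_/ d) (sym (cong₂ (λ m n → m * p + n) (toℕ-opposite j) (toℕ-opposite i))))
    where
    toℕ-opposite : ∀ {n} (k : Fin n) → toℕ (opposite k) ≡ n ∸ 1 ∸ toℕ k
    toℕ-opposite {n} k = trans (opposite-prop k) (sym (∸-+-assoc n 1 (toℕ k)))

  LineLike-H⇒Hℕ : LineLike (H p q d d∣pq) → LineLike (Hℕ p q d)
  LineLike-H⇒Hℕ = LineLike-transfer (⤖-id _)
    (λ {a b} → ⇔-sym (injection-⇔ toℕ toℕ-injective toℕ-tail {a} {b}))
    (λ {a b} → ⇔-sym (injection-⇔ toℕ toℕ-injective toℕ-head {a} {b}))

LineLike-Hℕ-transpose : ∀ {p q d} .{{_ : NonZero d}} → LineLike (Hℕ p q d) → LineLike (Hℕ q p d)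
LineLike-Hℕ-transpose {d = d} line = LineLike-transfer transpose-⤖
  (λ {a b} → injection-⇔ id id tail≗head∘transpose {a} {b})
  (⇔-id _)
  (LineLike-reverse line)
  where
  tail≗head∘transpose : ∀ x → position x / d ≡ position (transpose (transpose x)) / d
  tail≗head∘transpose x = cong (λ y → position y / d) (sym (transpose-involutive x))

∣1+n⇒∤n : ∀ {d n} → 1 < d → d ∣ suc n → ¬ d ∣ n
∣1+n⇒∤n {d} {n} 1<d d∣1+n d∣n =
  <⇒≢ 1<d (sym (∣1⇒≡1 (∣m+n∣m⇒∣n (subst (d ∣_) (+-comm 1 n) d∣1+n) d∣n)))

module _ {d} .{{_ : NonZero d}} where

  ∤1+m⇒[1+m]/d≡m/d : ∀ {m} → ¬ d ∣ suc m → suc m / d ≡ m / d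
  ∤1+m⇒[1+m]/d≡m/d {m} d∤1+m = ≤-antisym [1+m]/d≤m/d (/-monoˡ-≤ d (n≤1+n m))
    where
    k = suc m / d
    k*d<1+m : k * d < suc m
    k*d<1+m = ≤∧≢⇒< (m/n*n≤m (suc m) d) (λ k*d≡1+m → d∤1+m (divides k (sym k*d≡1+m)))
    [1+m]/d≤m/d : k ≤ m / d
    [1+m]/d≤m/d = subst (_≤ m / d) (m*n/n≡m k d) (/-monoˡ-≤ d (≤-pred k*d<1+m))

  m/d≡n/d⇒n<m+d : ∀ {m n} → m / d ≡ n / d → n < m + d
  m/d≡n/d⇒n<m+d {m} {n} m/d≡n/d = begin-strict
    n                  ≡⟨ m≡m%n+[m/n]*n n d ⟩
    n % d + n / d * d  <⟨ +-monoˡ-< (n / d * d) (m%n<n n d) ⟩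
    d + n / d * d      ≡⟨ cong (λ k → d + k * d) (sym m/d≡n/d) ⟩
    d + m / d * d      ≤⟨ +-monoʳ-≤ d (m/n*n≤m m d) ⟩
    d + m              ≡⟨ +-comm d m ⟩
    m + d              ∎
    where open ≤-Reasoning

  k<d⇒[k*n+r]/d<n : ∀ {k n r} → k < d → r < n → (k * n + r) / d < n
  k<d⇒[k*n+r]/d<n {k} {n} {r} k<d r<n =
    m<n*o⇒m/o<n (subst (k * n + r <_) (*-comm d n) (pair<pq k<d r<n))

  d≤k⇒n≤[k*n]/d : ∀ {k n} → d ≤ k → n ≤ k * n / d
  d≤k⇒n≤[k*n]/d {k} {n} d≤k =
    subst (_≤ k * n / d) (m*n/n≡m n d)
          (/-monoˡ-≤ d (subst (_≤ k * n) (*-comm d n) (*-monoˡ-≤ n d≤k)))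

q<d⇒¬LineLike : ∀ {p₂ q₁ d} .{{_ : NonZero d}} → 1 < d → suc q₁ < d →
                d ∣ (2 + p₂) * suc q₁ → ¬ LineLike (Hℕ (2 + p₂) (suc q₁) d)
q<d⇒¬LineLike {p₂} {q₁} {d} 1<d q<d d∣pq line = x≢y (parallel-free same-tail same-head)
  where
  open LineLike line
  open Digraph (Hℕ (2 + p₂) (suc q₁) d) using (tail; head)
  p = 2 + p₂
  q = suc q₁

  x y : Fin p × Fin q
  x = zero , zero
  y = suc zero , zero

  x≢y : x ≢ y
  x≢y ()

  same-tail : tail x ≡ tail y
  same-tail = trans (m<n⇒m/n≡0 (<-trans z<s 1<d))
                    (sym (m<n⇒m/n≡0 (subst (_< d) (sym position-y) q<d)))
    where
    position-y : position y ≡ q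
    position-y = trans (+-identityʳ (1 * q)) (*-identityˡ q)

  d∤pq-1 : ¬ d ∣ suc (q₁ * p + p₂)
  d∤pq-1 = ∣1+n⇒∤n 1<d (subst (d ∣_) pq≡2+[pq-2] d∣pq)
    where
    pq≡2+[pq-2] : (2 + p₂) * suc q₁ ≡ suc (suc (q₁ * (2 + p₂) + p₂))
    pq≡2+[pq-2] = solve (p₂ ∷ q₁ ∷ [])

  same-head : head x ≡ head y
  same-head = begin
    head x                  ≡⟨ cong (_/ d) (position-transpose {p} {q} zero zero) ⟩
    (q₁ * p + suc p₂) / d   ≡⟨ cong (_/ d) (+-suc (q₁ * p) p₂) ⟩
    suc (q₁ * p + p₂) / d   ≡⟨ ∤1+m⇒[1+m]/d≡m/d d∤pq-1 ⟩
    (q₁ * p + p₂) / d       ≡⟨ cong (_/ d) (position-transpose {p} {q} (suc zero) zero) ⟨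
    head y                  ∎
    where open ≡-Reasoning

∤q∧d<q⇒¬LineLike : ∀ {p₂ q₁ d} .{{_ : NonZero d}} → 1 < d → ¬ d ∣ suc q₁ →
                   d < suc q₁ → d ∣ (2 + p₂) * suc q₁ → ¬ LineLike (Hℕ (2 + p₂) (suc q₁) d)
∤q∧d<q⇒¬LineLike {p₂} {q₁} {d} 1<d d∤q d<q d∣pq line =
  let e , tail-e , head-e = closed {a} {b} {c} same-tail same-head
  in <⇒≱ (leaves-last-block⇒head<p e tail-e) (subst (p ≤_) (sym head-e) p≤head-c)
  where
  open LineLike line
  open Digraph (Hℕ (2 + p₂) (suc q₁) d) using (tail; head)
  p = 2 + p₂
  q = suc q₁

  -- a = (p-2 , q-1), b = (p-1 , q-1) and c = (p-1 , 0)
  a b c : Fin p × Fin q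
  a = transpose (zero , suc zero)
  b = transpose (zero , zero)
  c = opposite zero , zero

  d∤[p-1]q : ¬ d ∣ suc (p₂ * q + q₁)
  d∤[p-1]q d∣[p-1]q = d∤q (∣m+n∣m⇒∣n (subst (d ∣_) pq≡[p-1]q+q d∣pq) d∣[p-1]q)
    where
    pq≡[p-1]q+q : (2 + p₂) * suc q₁ ≡ suc (p₂ * suc q₁ + q₁) + suc q₁
    pq≡[p-1]q+q = solve (p₂ ∷ q₁ ∷ [])

  same-tail : tail a ≡ tail c
  same-tail = begin
    tail a                  ≡⟨ cong (_/ d) position-a ⟩
    (p₂ * q + q₁) / d       ≡⟨ ∤1+m⇒[1+m]/d≡m/d d∤[p-1]q ⟨
    suc (p₂ * q + q₁) / d   ≡⟨ cong (_/ d) [1+p₂]q≡1+[p₂q+q₁] ⟨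
    (suc p₂ * q + 0) / d    ≡⟨ cong (λ i → (i * q + 0) / d) (opposite-prop {p} zero) ⟨
    tail c                  ∎
    where
    open ≡-Reasoning
    position-a : position a ≡ p₂ * q + q₁
    position-a = cong₂ (λ i j → i * q + j) (opposite-prop {p} (suc zero)) (opposite-prop {q} zero)
    [1+p₂]q≡1+[p₂q+q₁] : suc p₂ * suc q₁ + 0 ≡ suc (p₂ * suc q₁ + q₁)
    [1+p₂]q≡1+[p₂q+q₁] = solve (p₂ ∷ q₁ ∷ [])

  same-head : head a ≡ head b
  same-head = begin
    head a  ≡⟨ cong (λ x → position x / d) (transpose-involutive {q} {p} (zero , suc zero)) ⟩
    1 / d   ≡⟨ m<n⇒m/n≡0 1<d ⟩
    0       ≡⟨ m<n⇒m/n≡0 (<-trans z<s 1<d) ⟨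
    0 / d   ≡⟨ cong (λ x → position x / d) (transpose-involutive {q} {p} (zero , zero)) ⟨
    head b  ∎
    where open ≡-Reasoning

  p≤head-c : p ≤ head c
  p≤head-c = begin
    p                 ≤⟨ d≤k⇒n≤[k*n]/d (≤-pred d<q) ⟩
    q₁ * p / d        ≡⟨ cong (_/ d) (+-identityʳ (q₁ * p)) ⟨
    (q₁ * p + 0) / d  ≡⟨ cong (_/ d) position-ᵀc ⟨
    head c            ∎
    where
    open ≤-Reasoning
    position-ᵀc : position (transpose c) ≡ q₁ * p + 0
    position-ᵀc = cong₂ (λ i j → i * p + j) (opposite-prop {q} zero)
                                            (cong toℕ (opposite-involutive {p} zero))

  leaves-last-block⇒head<p : ∀ x → tail x ≡ tail b → head x < p
  leaves-last-block⇒head<p (i , j) tail-x = k<d⇒[k*n+r]/d<n opposite-j<d (toℕ<n (opposite i))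
    where
    position-b : position b ≡ suc p₂ * q + q₁
    position-b = cong₂ (λ i j → i * q + j) (opposite-prop {p} zero) (opposite-prop {q} zero)
    q₁<j+d : q₁ < toℕ j + d
    q₁<j+d = +-cancelˡ-< (suc p₂ * q) q₁ (toℕ j + d) (begin-strict
      suc p₂ * q + q₁          ≡⟨ position-b ⟨
      position b               <⟨ m/d≡n/d⇒n<m+d tail-x ⟩
      toℕ i * q + toℕ j + d    ≡⟨ +-assoc (toℕ i * q) (toℕ j) d ⟩
      toℕ i * q + (toℕ j + d)  ≤⟨ +-monoˡ-≤ (toℕ j + d) (*-monoˡ-≤ q (≤-pred (toℕ<n i))) ⟩
      suc p₂ * q + (toℕ j + d) ∎)
      where open ≤-Reasoning
    opposite-j<d : toℕ (opposite j) < d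
    opposite-j<d = subst (_< d) (sym (opposite-prop j)) (m<n+o⇒m∸n<o q₁ (toℕ j) q₁<j+d)

LineLike⇒d∣q : ∀ {p₁ q d} .{{_ : NonZero d}} → 1 < d → d ∣ suc p₁ * q →
               LineLike (Hℕ (suc p₁) q d) → d ∣ q
LineLike⇒d∣q {q = zero} {d} _ _ _ = d ∣0
LineLike⇒d∣q {zero} {suc q₁} {d} _ d∣pq _ = subst (d ∣_) (*-identityˡ (suc q₁)) d∣pq
LineLike⇒d∣q {suc p₂} {suc q₁} {d} 1<d d∣pq line with d ∣? suc q₁ | <-cmp (suc q₁) d
... | yes d∣q | _               = d∣q
... | no d∤q  | tri< q<d _ _    = contradiction line (q<d⇒¬LineLike 1<d q<d d∣pq)
... | no d∤q  | tri≈ _ q≡d _    = contradiction (subst (d ∣_) (sym q≡d) ∣-refl) d∤q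
... | no d∤q  | tri> _ _ d<q    = contradiction line (∤q∧d<q⇒¬LineLike 1<d d∤q d<q d∣pq)

theorem3p3 : ∀ (p q d : ℕ) → 1 ≤ p → 1 ≤ q → 1 < d → .{{_ : NonZero d}}
    → (d∣pq : d ∣ p * q) → IsLineDigraph (H p q d d∣pq) → d ∣ gcd p q
theorem3p3 (suc p₁) (suc q₁) d _ _ 1<d d∣pq isLine = gcd-greatest d∣p d∣q
  where
  line : LineLike (Hℕ (suc p₁) (suc q₁) d)
  line = LineLike-H⇒Hℕ d∣pq (IsLineDigraph⇒LineLike isLine)

  d∣q : d ∣ suc q₁
  d∣q = LineLike⇒d∣q 1<d d∣pq line

  d∣p : d ∣ suc p₁
  d∣p = LineLike⇒d∣q 1<d (subst (d ∣_) (*-comm (suc p₁) (suc q₁)) d∣pq)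
                          (LineLike-Hℕ-transpose line)
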